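{- A finite simple graph $G$ is a proper color-line graph if and only if $G$ admits a vertex clique partition $\mathcal{C}$ (that is, $V(G)=\bigcup_{Q\in\mathcal{C}}Q$ with the members of $\mathcal{C}$ pairwise disjoint cliques) such that the graph $G\setminus\big(\bigcup_{Q\in\mathcal{C}}E(Q)\big)$, obtained from $G$ by deleting all edges with both endpoints in a common member of $\mathcal{C}$, is a line graph.
   Context: All graphs are finite and simple. An edge coloring $\phi$ of a graph $H$ is proper if any two distinct edges sharing an endvertex get different colors. For an edge-colored graph $(H,\phi)$, the color-line graph $\mathrm{CL}(H)$ has vertex set $E(H)$, two distinct vertices being adjacent iff the corresponding edges of $H$ share an endvertex or have the same color. $G$ is a proper color-line graph if $G\cong\mathrm{CL}(H)$ for some graph $H$ with a proper edge coloring. The line graph $L(H)$ has vertex set $E(H)$, two edges adjacent iff they share an endvertex; a line graph is a graph isomorphic to $L(H)$ for some graph $H$. For a set $Q$ of vertices, $E(Q)$ is the set of edges of $G$ with both endpoints in $Q$. -}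

module Defs where

open import Data.Nat using (ℕ)
open import Data.Fin using (Fin)
open import Data.Product using (Σ; _×_; _,_; proj₁; proj₂; ∃)
open import Data.Sum using (_⊎_; inj₁; inj₂)
open import Relation.Binary.PropositionalEquality using (_≡_; _≢_; refl; sym)
open import Relation.Nullary using (¬_)
open import Function.Bundles using (_↔_; Inverse)

record Graph (n : ℕ) : Set₁ where
  field
    Adj    : Fin n → Fin n → Set
    adj-sym : ∀ {u v} → Adj u v → Adj v u
    irrefl  : ∀ {u} → ¬ Adj u u
open Graph public using (Adj; irrefl)

_≅_ : ∀ {n k} → Graph n → Graph k → Set
_≅_ {n} {k} G H = Σ (Fin n ↔ Fin k) λ f →
  ∀ u v → (Adj G u v → Adj H (Inverse.to f u) (Inverse.to f v))
        × (Adj H (Inverse.to f u) (Inverse.to f v) → Adj G u v)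

-- A finite simple graph H given by its vertex set Fin m and an enumeration
-- of its edge set E(H) by Fin k: edge i has endpoints ends i.
record EdgeGraph : Set where
  field
    m k      : ℕ
    ends     : Fin k → Fin m × Fin m
    loopless : ∀ i → proj₁ (ends i) ≢ proj₂ (ends i)
    distinct : ∀ i j → i ≢ j →
               ¬ ((proj₁ (ends i) ≡ proj₁ (ends j) × proj₂ (ends i) ≡ proj₂ (ends j))
                ⊎ (proj₁ (ends i) ≡ proj₂ (ends j) × proj₂ (ends i) ≡ proj₁ (ends j)))
open EdgeGraph public

Incident : (H : EdgeGraph) → Fin (m H) → Fin (k H) → Set
Incident H x i = (x ≡ proj₁ (ends H i)) ⊎ (x ≡ proj₂ (ends H i))

ShareEnd : (H : EdgeGraph) → Fin (k H) → Fin (k H) → Set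
ShareEnd H i j = ∃ λ x → Incident H x i × Incident H x j

IsProper : (H : EdgeGraph) → (Fin (k H) → ℕ) → Set
IsProper H φ = ∀ i j → i ≢ j → ShareEnd H i j → φ i ≢ φ j

lineGraph : (H : EdgeGraph) → Graph (k H)
lineGraph H = record
  { Adj = λ i j → i ≢ j × ShareEnd H i j
  ; adj-sym = λ { (ne , x , a , b) → (λ e → ne (sym e)) , x , b , a }
  ; irrefl = λ { (ne , _) → ne refl }
  }

colorLineGraph : (H : EdgeGraph) → (Fin (k H) → ℕ) → Graph (k H)
colorLineGraph H φ = record
  { Adj = λ i j → i ≢ j × (ShareEnd H i j ⊎ φ i ≡ φ j)
  ; adj-sym = λ { (ne , inj₁ (x , a , b)) → (λ e → ne (sym e)) , inj₁ (x , b , a)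
            ; (ne , inj₂ p) → (λ e → ne (sym e)) , inj₂ (sym p) }
  ; irrefl = λ { (ne , _) → ne refl }
  }

IsLineGraph : ∀ {n} → Graph n → Set
IsLineGraph {n} G = Σ EdgeGraph λ H → G ≅ lineGraph H

IsProperColorLineGraph : ∀ {n} → Graph n → Set
IsProperColorLineGraph {n} G =
  Σ EdgeGraph λ H → Σ (Fin (k H) → ℕ) λ φ → IsProper H φ × G ≅ colorLineGraph H φ

-- A vertex clique partition, given as a labelling c : V(G) → ℕ whose
-- (nonempty) label classes are the members Q of the partition; each class
-- must be a clique.
IsCliquePartition : ∀ {n} → Graph n → (Fin n → ℕ) → Set
IsCliquePartition {n} G c = ∀ u v → u ≢ v → c u ≡ c v → Adj G u v

removeInner : ∀ {n} → (G : Graph n) → (Fin n → ℕ) → Graph n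
removeInner G c = record
  { Adj = λ u v → Adj G u v × c u ≢ c v
  ; adj-sym = λ { (a , ne) → Graph.adj-sym G a , (λ e → ne (sym e)) }
  ; irrefl = λ { (a , _) → irrefl G a }
  }

-- In CL(H, φ) every colour class is a clique, and for a proper φ two edges of
-- the same colour never share an endvertex, so deleting the edges inside the
-- colour classes leaves exactly L(H).  Conversely, given a clique partition c
-- with G ∖ E(c) ≅ L(H), colour each edge of H by the class of the vertex of G
-- it corresponds to: the edges of L(H) join different classes, so the
-- colouring is proper, and putting the class cliques back recovers G as CL(H).
module Submission where

open import Defs
open import Data.Nat using (ℕ; _≟_)
open import Data.Fin using (Fin)
open import Data.Product using (Σ; _×_; _,_; proj₁; proj₂)
open import Data.Sum using (inj₁; inj₂)
open import Data.Empty using (⊥-elim)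
open import Function.Base using (_∘_)
open import Function.Bundles using (_⇔_; mk⇔; Inverse; Injection)
open import Function.Properties.Inverse using (↔-sym; ↔-trans; Inverse⇒Injection)
open import Function.Construct.Identity using (↔-id)
open import Relation.Nullary using (yes; no)
open import Relation.Binary.PropositionalEquality using (_≡_; sym; trans; cong; subst; subst₂)

private
  variable
    n n′ n″ : ℕ

module IsoProperties {G : Graph n} {K : Graph n′} (iso : G ≅ K) where
  open Inverse (proj₁ iso)

  ≅-injective : ∀ {u v} → to u ≡ to v → u ≡ v
  ≅-injective = Injection.injective (Inverse⇒Injection (proj₁ iso))

  ≅-preserves : ∀ {u v} → Adj G u v → Adj K (to u) (to v)
  ≅-preserves {u} {v} = proj₁ (proj₂ iso u v)

  ≅-reflects : ∀ {u v} → Adj K (to u) (to v) → Adj G u v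
  ≅-reflects {u} {v} = proj₂ (proj₂ iso u v)

  ≅-reflects-from : ∀ {i j} → Adj K i j → Adj G (from i) (from j)
  ≅-reflects-from {i} {j} a =
    ≅-reflects (subst₂ (Adj K) (sym (strictlyInverseˡ i)) (sym (strictlyInverseˡ j)) a)

  ≅-sym : K ≅ G
  ≅-sym = ↔-sym (proj₁ iso) , λ _ _ → ≅-reflects-from , ≅-preserves-from
    where
    ≅-preserves-from : ∀ {i j} → Adj G (from i) (from j) → Adj K i j
    ≅-preserves-from {i} {j} a =
      subst₂ (Adj K) (strictlyInverseˡ i) (strictlyInverseˡ j) (≅-preserves a)

  IsCliquePartition-≅ : ∀ {c} → IsCliquePartition K c → IsCliquePartition G (c ∘ to)
  IsCliquePartition-≅ cp u v u≢v same =
    ≅-reflects (cp (to u) (to v) (u≢v ∘ ≅-injective) same)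

  removeInner-≅ : (c : Fin n′ → ℕ) → removeInner G (c ∘ to) ≅ removeInner K c
  removeInner-≅ c = proj₁ iso , λ u v →
    (λ (a , different) → ≅-preserves a , different) ,
    (λ (a , different) → ≅-reflects a , different)

open IsoProperties public

≅-trans : {G : Graph n} {K : Graph n′} {M : Graph n″} → G ≅ K → K ≅ M → G ≅ M
≅-trans (f , G≅K) (g , K≅M) = ↔-trans f g , λ u v →
  (proj₁ (K≅M _ _) ∘ proj₁ (G≅K u v)) , (proj₂ (G≅K u v) ∘ proj₂ (K≅M _ _))

≅-from-removeInner : {G : Graph n} {K : Graph n′} {c : Fin n → ℕ} {c′ : Fin n′ → ℕ} →
  IsCliquePartition G c → IsCliquePartition K c′ →
  (iso : removeInner G c ≅ removeInner K c′) →
  (∀ u → c′ (Inverse.to (proj₁ iso) u) ≡ c u) → G ≅ K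
≅-from-removeInner {G = G} {K} {c} {c′} cp cp′ iso labels = proj₁ iso , λ _ _ → there , back
  where
  open Inverse (proj₁ iso)
  module Iso = IsoProperties {G = removeInner G c} {K = removeInner K c′} iso

  there : ∀ {u v} → Adj G u v → Adj K (to u) (to v)
  there {u} {v} a with c u ≟ c v
  ... | yes same = cp′ (to u) (to v) (λ e → irrefl G (subst (Adj G u) (sym (Iso.≅-injective e)) a))
                                    (trans (labels u) (trans same (sym (labels v))))
  ... | no different = proj₁ (Iso.≅-preserves (a , different))

  back : ∀ {u v} → Adj K (to u) (to v) → Adj G u v
  back {u} {v} a with c′ (to u) ≟ c′ (to v)
  ... | yes same = cp u v (λ e → irrefl K (subst (Adj K (to u)) (cong to (sym e)) a))
                          (trans (sym (labels u)) (trans same (labels v)))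
  ... | no different = proj₁ (Iso.≅-reflects (a , different))

module _ (H : EdgeGraph) (φ : Fin (k H) → ℕ) where

  colourClasses-isCliquePartition : IsCliquePartition (colorLineGraph H φ) φ
  colourClasses-isCliquePartition i j i≢j same = i≢j , inj₂ same

  removeInner-colorLineGraph : IsProper H φ → removeInner (colorLineGraph H φ) φ ≅ lineGraph H
  removeInner-colorLineGraph proper = ↔-id _ , λ _ _ → there , back
    where
    there : ∀ {i j} → Adj (removeInner (colorLineGraph H φ) φ) i j → Adj (lineGraph H) i j
    there ((i≢j , inj₁ share) , _) = i≢j , share
    there ((_ , inj₂ same) , different) = ⊥-elim (different same)

    back : ∀ {i j} → Adj (lineGraph H) i j → Adj (removeInner (colorLineGraph H φ) φ) i j
    back {i} {j} (i≢j , share) = (i≢j , inj₁ share) , proper i j i≢j share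

HasLineGraphCliquePartition : Graph n → Set
HasLineGraphCliquePartition {n} G =
  Σ (Fin n → ℕ) (λ c → IsCliquePartition G c × IsLineGraph (removeInner G c))

IsProperColorLineGraph⇒HasLineGraphCliquePartition : (G : Graph n) →
  IsProperColorLineGraph G → HasLineGraphCliquePartition G
IsProperColorLineGraph⇒HasLineGraphCliquePartition {n} G (H , φ , proper , iso) =
  c , partition , H , between-classes
  where
  CL : Graph (k H)
  CL = colorLineGraph H φ

  c : Fin n → ℕ
  c = φ ∘ Inverse.to (proj₁ iso)

  partition : IsCliquePartition G c
  partition = IsCliquePartition-≅ {G = G} {K = CL} iso (colourClasses-isCliquePartition H φ)

  between-classes : removeInner G c ≅ lineGraph H
  between-classes = ≅-trans {G = removeInner G c} {K = removeInner CL φ} {M = lineGraph H}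
    (removeInner-≅ {G = G} {K = CL} iso φ) (removeInner-colorLineGraph H φ proper)

HasLineGraphCliquePartition⇒IsProperColorLineGraph : (G : Graph n) →
  HasLineGraphCliquePartition G → IsProperColorLineGraph G
HasLineGraphCliquePartition⇒IsProperColorLineGraph G (c , cp , H , iso) = H , φ , proper , G≅CL
  where
  φ : Fin (k H) → ℕ
  φ = c ∘ Inverse.from (proj₁ iso)

  CL : Graph (k H)
  CL = colorLineGraph H φ

  proper : IsProper H φ
  proper i j i≢j share =
    proj₂ (≅-reflects-from {G = removeInner G c} {K = lineGraph H} iso (i≢j , share))

  between-classes : removeInner G c ≅ removeInner CL φ
  between-classes = ≅-trans {G = removeInner G c} {K = lineGraph H} {M = removeInner CL φ}
    iso (≅-sym {G = removeInner CL φ} {K = lineGraph H} (removeInner-colorLineGraph H φ proper))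

  G≅CL : G ≅ CL
  G≅CL = ≅-from-removeInner {G = G} {K = CL} cp (colourClasses-isCliquePartition H φ)
    between-classes (cong c ∘ Inverse.strictlyInverseʳ (proj₁ iso))

theorem5 : ∀ {n} (G : Graph n) →
    IsProperColorLineGraph G ⇔ Σ (Fin n → ℕ) (λ c → IsCliquePartition G c × IsLineGraph (removeInner G c))
theorem5 G = mk⇔ (IsProperColorLineGraph⇒HasLineGraphCliquePartition G)
                 (HasLineGraphCliquePartition⇒IsProperColorLineGraph G)
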